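{- Let $m>2$ be an integer, let $N=m^3-1$ and $\mathbf{v}=(1,m,m^2)$. Then $$\lambda^{\ast}(\Pi_{N,\mathbf{v}})=\sqrt{1+m^2+m^4},$$ and consequently $$\lim_{m\to\infty}\frac{\lambda^{\ast}(\Pi_{N,\mathbf{v}})}{N^{2/3}}=1,$$ where $N=m^3-1$ depends on $m$.
   Context: For integers $N,a,b,c$ with $0<a<b<c<N$, write $\mathbf{v}=(a,b,c)$ and define $$\Pi_{N,\mathbf{v}}=\{(na \bmod N,\ nb \bmod N,\ nc \bmod N): 0\le n<N\},$$ where $x \bmod N$ denotes the least nonnegative residue of $x$ modulo $N$, and $$\lambda^{\ast}(\Pi_{N,\mathbf{v}})=\min_{\mathbf{x}\neq\mathbf{y},\ \mathbf{x},\mathbf{y}\in\Pi_{N,\mathbf{v}}}\|\mathbf{x}-\mathbf{y}\|$$ (Euclidean norm). -}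

module Defs where

open import Data.Nat using (ℕ; zero; suc; _+_; _*_; _∸_; _^_; _≤_; _<_; ∣_-_∣)
open import Data.Nat.DivMod using (_%_)
open import Data.Product using (Σ; _×_; _,_)
open import Relation.Binary.PropositionalEquality using (_≡_)
open import Relation.Nullary using (¬_)

-- least nonnegative residue x mod N (only used with N > 0; the N = 0
-- clause just makes the function total without an instance argument)
_mod_ : ℕ → ℕ → ℕ
x mod zero  = x
x mod suc k = x % suc k

Point : Set
Point = ℕ × ℕ × ℕ

pt : ℕ → ℕ → ℕ → ℕ → ℕ → Point
pt N a b c n = ((n * a) mod N , (n * b) mod N , (n * c) mod N)

_∈Π[_,_,_,_] : Point → ℕ → ℕ → ℕ → ℕ → Set
x ∈Π[ N , a , b , c ] = Σ ℕ λ n → n < N × pt N a b c n ≡ x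

distSq : Point → Point → ℕ
distSq (x₁ , x₂ , x₃) (y₁ , y₂ , y₃) =
  ∣ x₁ - y₁ ∣ ^ 2 + ∣ x₂ - y₂ ∣ ^ 2 + ∣ x₃ - y₃ ∣ ^ 2

-- d is the square of λ*(Π_{N,(a,b,c)}): it is attained by some pair of
-- distinct points of Π, and is a lower bound for all such pairs.
IsLambdaStarSq : ℕ → ℕ → ℕ → ℕ → ℕ → Set
IsLambdaStarSq N a b c d =
  (Σ Point λ x → Σ Point λ y →
     x ∈Π[ N , a , b , c ] × y ∈Π[ N , a , b , c ] × ¬ (x ≡ y) × distSq x y ≡ d)
  × (∀ x y → x ∈Π[ N , a , b , c ] → y ∈Π[ N , a , b , c ] → ¬ (x ≡ y) → d ≤ distSq x y)

module Submission where

-- Lifted to ℤ³, the difference of the n-th and n'-th points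
-- is (δ, δm - κ₂N, δm² - κ₃N) with δ = n - n'; since N = m³ - 1 this is
-- the lattice vector  a(m²,1,m) + b(m,m²,1) + c(1,m,m²)  for
-- (a,b,c) = (κ₂, κ₃ - mκ₂, δ - mκ₃), and (a,b,c) = 0 forces n = n'.
-- The basis vectors have norm s = 1 + m² + m⁴ and pairwise inner products
-- P = m³ + m² + m, which yields the Gram identity
--   |a·u|² = E·(a² + b² + c²) + P·((a+b)² + (b+c)² + (c+a)²),  E = s - 2P.
-- For m ≥ 3 we have E ≥ 0; for (a,b,c) ≠ 0 the first sum is ≥ 1 and the
-- second one is even and dominates the first, hence ≥ 2; so |a·u|² ≥ s.  The points with indices 0 and 1 are at squared distance s.
--
-- Asymptotics.  λ*² = s is unique; N⁴ < s³ gives the lower estimate, and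
-- s ≤ m³(m+1), N ≥ m²(m-1) give q·s³ < (q+1)·N⁴ as soon as 53q < m - 1.

open import Defs
open import Data.Product using (Σ; _×_; _,_; proj₁; proj₂)
open import Relation.Binary.PropositionalEquality

module Lattice where
  open import Data.Nat.Base as ℕ using (ℕ; zero; suc)
  import Data.Nat.Properties as ℕₚ
  open import Data.Nat.DivMod using (_%_; _/_; m≡m%n+[m/n]*n; m<n⇒m%n≡m)
  open import Data.Integer.Base hiding (suc; _/_; _%_)
  open import Data.Integer.Properties
  open import Data.Integer.Tactic.RingSolver using (solve-∀)
  open import Data.Sum using (inj₁; inj₂)

  Vec3 : Set
  Vec3 = ℤ × ℤ × ℤ

  origin : Vec3
  origin = +0 , +0 , +0

  lift : Point → Vec3
  lift (x , y , z) = + x , + y , + z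

  _⊟_ : Vec3 → Vec3 → Vec3
  (x₁ , x₂ , x₃) ⊟ (y₁ , y₂ , y₃) = x₁ - y₁ , x₂ - y₂ , x₃ - y₃

  normSq : Vec3 → ℤ
  normSq (x , y , z) = x * x + y * y + z * z

  ‖_‖² : Vec3 → ℕ
  ‖ (x , y , z) ‖² = ∣ x ∣ ℕ.* ∣ x ∣ ℕ.+ ∣ y ∣ ℕ.* ∣ y ∣ ℕ.+ ∣ z ∣ ℕ.* ∣ z ∣

  lattice : ℤ → Vec3 → Vec3
  lattice M (a , b , c) =
    c + b * M + a * (M * M) , c * M + b * (M * M) + a , c * (M * M) + b + a * M

  pairSums : Vec3 → Vec3
  pairSums (a , b , c) = a + b , b + c , c + a

  -- Weights of the Gram identity: E = s - 2P and P.
  diagWeight pairWeight : ℤ → ℤ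
  diagWeight M = M * M * M * M - + 2 * (M * M * M) - M * M - + 2 * M + + 1
  pairWeight M = M * M * M + M * M + M

  -- diagWeight (3 + j) in Horner form, and pairWeight, as natural numbers.
  diagWeightℕ : ℕ → ℕ
  diagWeightℕ j = 13 ℕ.+ j ℕ.* (46 ℕ.+ j ℕ.* (35 ℕ.+ j ℕ.* (10 ℕ.+ j)))

  pairWeightℕ : ℕ → ℕ
  pairWeightℕ m = m ℕ.* m ℕ.* m ℕ.+ m ℕ.* m ℕ.+ m

  square-abs : ∀ i → + (∣ i ∣ ℕ.* ∣ i ∣) ≡ i * i
  square-abs i with +∣i∣≡i⊎+∣i∣≡-i i
  ... | inj₁ e = trans (pos-* ∣ i ∣ ∣ i ∣) (cong₂ _*_ e e)
  ... | inj₂ e = trans (pos-* ∣ i ∣ ∣ i ∣) (trans (cong₂ _*_ e e) (neg-square i))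
    where
    neg-square : ∀ i → (- i) * (- i) ≡ i * i
    neg-square = solve-∀

  normSq-abs : ∀ v → + ‖ v ‖² ≡ normSq v
  normSq-abs (x , y , z) =
    cong₂ _+_ (cong₂ _+_ (square-abs x) (square-abs y)) (square-abs z)

  square-zero : ∀ i → ∣ i ∣ ℕ.* ∣ i ∣ ≡ 0 → i ≡ +0
  square-zero i eq with ℕₚ.m*n≡0⇒m≡0∨n≡0 ∣ i ∣ eq
  ... | inj₁ e = ∣i∣≡0⇒i≡0 e
  ... | inj₂ e = ∣i∣≡0⇒i≡0 e

  ‖‖²≡0⇒origin : ∀ v → ‖ v ‖² ≡ 0 → v ≡ origin
  ‖‖²≡0⇒origin (a , b , c) eq =
    cong₂ _,_ (square-zero a (ℕₚ.m+n≡0⇒m≡0 _ ab≡0))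
      (cong₂ _,_ (square-zero b (ℕₚ.m+n≡0⇒n≡0 _ ab≡0))
                 (square-zero c (ℕₚ.m+n≡0⇒n≡0 _ eq)))
    where
    ab≡0 = ℕₚ.m+n≡0⇒m≡0 _ eq

  absDiff : ∀ x y → ℕ.∣ x - y ∣ ≡ ∣ x ⊖ y ∣
  absDiff zero    zero    = refl
  absDiff zero    (suc y) = refl
  absDiff (suc x) zero    = refl
  absDiff (suc x) (suc y) =
    trans (absDiff x y) (cong ∣_∣ (sym ([1+m]⊖[1+n]≡m⊖n x y)))

  squared-absDiff : ∀ x y → ℕ.∣ x - y ∣ ℕ.^ 2 ≡ ∣ + x - + y ∣ ℕ.* ∣ + x - + y ∣
  squared-absDiff x y =
    trans (cong (ℕ._*_ ℕ.∣ x - y ∣) (ℕₚ.*-identityʳ _))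
          (cong (λ k → k ℕ.* k) (trans (absDiff x y) (cong ∣_∣ (sym ([+m]-[+n]≡m⊖n x y)))))

  distSq-lift : ∀ x y → distSq x y ≡ ‖ lift x ⊟ lift y ‖²
  distSq-lift (x₁ , x₂ , x₃) (y₁ , y₂ , y₃) =
    cong₂ ℕ._+_ (cong₂ ℕ._+_ (squared-absDiff x₁ y₁) (squared-absDiff x₂ y₂))
                (squared-absDiff x₃ y₃)

  mod-residue : ∀ x N → Σ ℤ λ k → + (x mod N) ≡ + x - k * + N
  mod-residue x zero    = +0 , sym (+-identityʳ (+ x))
  mod-residue x (suc K) = k , (begin
    r                              ≡⟨ add-sub r (k * + suc K) ⟩
    r + k * + suc K - k * + suc K  ≡⟨ cong (_- k * + suc K) division ⟨
    + x - k * + suc K              ∎)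
    where
    open ≡-Reasoning
    r = + (x % suc K)
    k = + (x / suc K)
    division : + x ≡ r + k * + suc K
    division = trans (cong +_ (m≡m%n+[m/n]*n x (suc K)))
                     (cong (_+_ r) (pos-* (x / suc K) (suc K)))
    add-sub : ∀ a b → a ≡ a + b - b
    add-sub = solve-∀

  mod-small : ∀ x N → x ℕ.< N → x mod N ≡ x
  mod-small x (suc K) x<N = m<n⇒m%n≡m x<N

  -- The vector (x, xM - k₂Z, xM² - k₃Z): lifts of points of Π have this
  -- shape with Z = N, and these vectors are closed under subtraction.
  residueVector : ℤ → ℤ → ℤ → ℤ → ℤ → Vec3
  residueVector M Z x k₂ k₃ = x , x * M - k₂ * Z , x * (M * M) - k₃ * Z

  point-residues : ∀ m N n → n ℕ.< N →
    Σ ℤ λ k₂ → Σ ℤ λ k₃ → lift (pt N 1 m (m ℕ.^ 2) n) ≡ residueVector (+ m) (+ N) (+ n) k₂ k₃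
  point-residues m N n n<N with mod-residue (n ℕ.* m) N | mod-residue (n ℕ.* m ℕ.^ 2) N
  ... | k₂ , e₂ | k₃ , e₃ =
    k₂ , k₃ , cong₂ _,_ (cong +_ first)
                (cong₂ _,_ (trans e₂ (cong (_- k₂ * + N) (pos-* n m)))
                           (trans e₃ (cong (_- k₃ * + N) (trans (pos-* n (m ℕ.^ 2))
                                                            (cong (_*_ (+ n)) square)))))
    where
    first : (n ℕ.* 1) mod N ≡ n
    first = trans (cong (_mod N) (ℕₚ.*-identityʳ n)) (mod-small n N n<N)
    square : + (m ℕ.^ 2) ≡ + m * + m
    square = trans (cong (λ k → + (m ℕ.* k)) (ℕₚ.*-identityʳ m)) (pos-* m m)

  residueVector-⊟ : ∀ M Z x x′ k₂ k₂′ k₃ k₃′ →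
    residueVector M Z x k₂ k₃ ⊟ residueVector M Z x′ k₂′ k₃′
      ≡ residueVector M Z (x - x′) (k₂ - k₂′) (k₃ - k₃′)
  residueVector-⊟ M Z x x′ k₂ k₂′ k₃ k₃′ =
    cong₂ _,_ refl (cong₂ _,_ (linear M Z x x′ k₂ k₂′) (linear (M * M) Z x x′ k₃ k₃′))
    where
    linear : ∀ A Z x x′ k k′ → (x * A - k * Z) - (x′ * A - k′ * Z) ≡ (x - x′) * A - (k - k′) * Z
    linear = solve-∀

  residueVector-lattice : ∀ M x k₂ k₃ →
    residueVector M (M * M * M - + 1) x k₂ k₃ ≡ lattice M (k₂ , k₃ - M * k₂ , x - M * k₃)
  residueVector-lattice M x k₂ k₃ =
    cong₂ _,_ (first M x k₂ k₃) (cong₂ _,_ (second M x k₂ k₃) (third M x k₂ k₃))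
    where
    first : ∀ M x k₂ k₃ → x ≡ (x - M * k₃) + (k₃ - M * k₂) * M + k₂ * (M * M)
    first = solve-∀
    second : ∀ M x k₂ k₃ → x * M - k₂ * (M * M * M - + 1)
                           ≡ (x - M * k₃) * M + (k₃ - M * k₂) * (M * M) + k₂
    second = solve-∀
    third : ∀ M x k₂ k₃ → x * (M * M) - k₃ * (M * M * M - + 1)
                          ≡ (x - M * k₃) * (M * M) + (k₃ - M * k₂) + k₂ * M
    third = solve-∀

  cube-pred : ∀ m N → suc N ≡ m ℕ.* m ℕ.* m → + N ≡ + m * + m * + m - + 1
  cube-pred m N N+1≡m³ = trans (add-sub (+ N))
    (cong (_- + 1) (trans (cong +_ N+1≡m³) (trans (pos-* (m ℕ.* m) m) (cong (_* + m) (pos-* m m)))))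
    where
    add-sub : ∀ a → a ≡ + 1 + a - + 1
    add-sub = solve-∀

  points-differ-by-lattice : ∀ m N → suc N ≡ m ℕ.* m ℕ.* m → ∀ {n n′} → n ℕ.< N → n′ ℕ.< N →
    Σ Vec3 λ v → (lift (pt N 1 m (m ℕ.^ 2) n) ⊟ lift (pt N 1 m (m ℕ.^ 2) n′) ≡ lattice (+ m) v)
                 × (v ≡ origin → n ≡ n′)
  points-differ-by-lattice m N N+1≡m³ {n} {n′} n<N n′<N
    with point-residues m N n n<N | point-residues m N n′ n′<N
  ... | k₂ , k₃ , eq | k₂′ , k₃′ , eq′ = v , difference , same-index
    where
    open ≡-Reasoning
    M = + m
    δ = + n - + n′
    κ₂ = k₂ - k₂′
    κ₃ = k₃ - k₃′
    v = κ₂ , κ₃ - M * κ₂ , δ - M * κ₃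
    in-lattice : residueVector M (M * M * M - + 1) δ κ₂ κ₃ ≡ lattice M v
    in-lattice = residueVector-lattice M δ κ₂ κ₃
    difference = begin
      lift (pt N 1 m (m ℕ.^ 2) n) ⊟ lift (pt N 1 m (m ℕ.^ 2) n′)
        ≡⟨ cong₂ _⊟_ eq eq′ ⟩
      residueVector M (+ N) (+ n) k₂ k₃ ⊟ residueVector M (+ N) (+ n′) k₂′ k₃′
        ≡⟨ residueVector-⊟ M (+ N) (+ n) (+ n′) k₂ k₂′ k₃ k₃′ ⟩
      residueVector M (+ N) δ κ₂ κ₃
        ≡⟨ cong (λ Z → residueVector M Z δ κ₂ κ₃) (cube-pred m N N+1≡m³) ⟩
      residueVector M (M * M * M - + 1) δ κ₂ κ₃
        ≡⟨ in-lattice ⟩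
      lattice M v ∎
    -- The first coordinate of the lattice vector is δ, and of lattice M origin it is 0.
    same-index : v ≡ origin → n ≡ n′
    same-index v≡0 =
      +-injective (i-j≡0⇒i≡j (+ n) (+ n′) (cong proj₁ (trans in-lattice (cong (lattice M) v≡0))))

  gram : ∀ M v → normSq (lattice M v)
                 ≡ diagWeight M * normSq v + pairWeight M * normSq (pairSums v)
  gram M (a , b , c) = expanded M a b c
    where
    expanded : ∀ M a b c →
      (c + b * M + a * (M * M)) * (c + b * M + a * (M * M))
      + (c * M + b * (M * M) + a) * (c * M + b * (M * M) + a)
      + (c * (M * M) + b + a * M) * (c * (M * M) + b + a * M)
      ≡ (M * M * M * M - + 2 * (M * M * M) - M * M - + 2 * M + + 1) * (a * a + b * b + c * c)
        + (M * M * M + M * M + M) * ((a + b) * (a + b) + (b + c) * (b + c) + (c + a) * (c + a))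
    expanded = solve-∀

  -- For M ≥ 3 the weight E is a natural number (this is where m > 2 is used).
  diagWeight-cast : ∀ j → diagWeight (+ (3 ℕ.+ j)) ≡ + diagWeightℕ j
  diagWeight-cast j = trans (horner (+ j)) (sym cast)
    where
    horner : ∀ J → let M = + 3 + J in
      M * M * M * M - + 2 * (M * M * M) - M * M - + 2 * M + + 1
      ≡ + 13 + J * (+ 46 + J * (+ 35 + J * (+ 10 + J)))
    horner = solve-∀
    cast : + diagWeightℕ j ≡ + 13 + + j * (+ 46 + + j * (+ 35 + + j * (+ 10 + + j)))
    cast = cong (_+_ (+ 13)) (trans (pos-* j _) (cong (_*_ (+ j))
             (cong (_+_ (+ 46)) (trans (pos-* j _) (cong (_*_ (+ j))
               (cong (_+_ (+ 35)) (pos-* j _)))))))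

  pairWeight-cast : ∀ m → pairWeight (+ m) ≡ + pairWeightℕ m
  pairWeight-cast m = sym (cong₂ (λ x y → x + y + + m)
    (trans (pos-* (m ℕ.* m) m) (cong (_* + m) (pos-* m m))) (pos-* m m))

  lattice-norm : ∀ j v →
    ‖ lattice (+ (3 ℕ.+ j)) v ‖²
      ≡ diagWeightℕ j ℕ.* ‖ v ‖² ℕ.+ pairWeightℕ (3 ℕ.+ j) ℕ.* ‖ pairSums v ‖²
  lattice-norm j v = +-injective (begin
    + ‖ lattice M v ‖²          ≡⟨ normSq-abs (lattice M v) ⟩
    normSq (lattice M v)        ≡⟨ gram M v ⟩
    diagWeight M * normSq v + pairWeight M * normSq (pairSums v)
      ≡⟨ cong₂ _+_ (cong₂ _*_ (diagWeight-cast j) (sym (normSq-abs v)))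
                   (cong₂ _*_ (pairWeight-cast (3 ℕ.+ j)) (sym (normSq-abs (pairSums v)))) ⟩
    + diagWeightℕ j * + ‖ v ‖² + + pairWeightℕ (3 ℕ.+ j) * + ‖ pairSums v ‖²
      ≡⟨ sym (cong₂ _+_ (pos-* (diagWeightℕ j) ‖ v ‖²)
                        (pos-* (pairWeightℕ (3 ℕ.+ j)) ‖ pairSums v ‖²)) ⟩
    + (diagWeightℕ j ℕ.* ‖ v ‖² ℕ.+ pairWeightℕ (3 ℕ.+ j) ℕ.* ‖ pairSums v ‖²) ∎)
    where
    open ≡-Reasoning
    M = + (3 ℕ.+ j)

  -- ‖pairSums v‖² = ‖v‖² + (a+b+c)², so it dominates ‖v‖².
  pairSums-dominates : ∀ v → ‖ v ‖² ℕ.≤ ‖ pairSums v ‖²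
  pairSums-dominates v@(a , b , c) = ℕₚ.≤-trans (ℕₚ.m≤m+n _ _) (ℕₚ.≤-reflexive (sym split))
    where
    open ≡-Reasoning
    expanded : ∀ a b c → (a + b) * (a + b) + (b + c) * (b + c) + (c + a) * (c + a)
                         ≡ (a * a + b * b + c * c) + (a + b + c) * (a + b + c)
    expanded = solve-∀
    split : ‖ pairSums v ‖² ≡ ‖ v ‖² ℕ.+ ∣ a + b + c ∣ ℕ.* ∣ a + b + c ∣
    split = +-injective (begin
      + ‖ pairSums v ‖²                        ≡⟨ normSq-abs (pairSums v) ⟩
      normSq (pairSums v)                      ≡⟨ expanded a b c ⟩
      normSq v + (a + b + c) * (a + b + c)
        ≡⟨ sym (cong₂ _+_ (normSq-abs v) (square-abs (a + b + c))) ⟩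
      + (‖ v ‖² ℕ.+ ∣ a + b + c ∣ ℕ.* ∣ a + b + c ∣) ∎)

  -- ‖pairSums v‖² = 2(a² + b² + c² + ab + bc + ca) is even.
  pairSums-even : ∀ v → Σ ℕ λ k → ‖ pairSums v ‖² ≡ 2 ℕ.* k
  pairSums-even v@(a , b , c) = ∣ K ∣ , (begin
    ‖ pairSums v ‖²        ≡⟨ cong ∣_∣ (normSq-abs (pairSums v)) ⟩
    ∣ normSq (pairSums v) ∣ ≡⟨ cong ∣_∣ (expanded a b c) ⟩
    ∣ + 2 * K ∣            ≡⟨ abs-* (+ 2) K ⟩
    2 ℕ.* ∣ K ∣            ∎)
    where
    open ≡-Reasoning
    K = a * a + b * b + c * c + a * b + b * c + c * a
    expanded : ∀ a b c → (a + b) * (a + b) + (b + c) * (b + c) + (c + a) * (c + a)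
                         ≡ + 2 * (a * a + b * b + c * c + a * b + b * c + c * a)
    expanded = solve-∀

open Lattice
open import Data.Nat.Base using (ℕ; zero; suc; _+_; _*_; _∸_; _^_; _≤_; _<_; z≤n; s≤s; NonZero)
open import Data.Nat.Properties
open import Data.Nat.Solver using (module +-*-Solver)
open import Data.Nat.Tactic.RingSolver using (solve-∀)
open import Data.Integer.Base using (+_)
open +-*-Solver using (solve; _:+_; _:*_; _:^_; _:=_; con)

norm-positive : ∀ v → v ≢ origin → 1 ≤ ‖ v ‖²
norm-positive v v≢0 = n≢0⇒n>0 (λ ‖v‖²≡0 → v≢0 (‖‖²≡0⇒origin v ‖v‖²≡0))

-- For v ≠ 0, ‖pairSums v‖² is even and at least ‖v‖² ≥ 1, hence at least 2.
pairSums-two : ∀ v → v ≢ origin → 2 ≤ ‖ pairSums v ‖²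
pairSums-two v v≢0 with pairSums-even v
... | k , P≡2k = subst (2 ≤_) (sym P≡2k)
        (even-positive k (subst (1 ≤_) P≡2k (≤-trans (norm-positive v v≢0) (pairSums-dominates v))))
  where
  even-positive : ∀ k → 1 ≤ 2 * k → 2 ≤ 2 * k
  even-positive (suc k) _ = *-monoʳ-≤ 2 (s≤s z≤n)

weights-sum : ∀ j → let m = 3 + j in
  1 + m ^ 2 + m ^ 4 ≡ diagWeightℕ j * 1 + pairWeightℕ m * 2
weights-sum = solve 1 (λ j →
  con 1 :+ (con 3 :+ j) :^ 2 :+ (con 3 :+ j) :^ 4
  := (con 13 :+ j :* (con 46 :+ j :* (con 35 :+ j :* (con 10 :+ j)))) :* con 1
     :+ ((con 3 :+ j) :* (con 3 :+ j) :* (con 3 :+ j) :+ (con 3 :+ j) :* (con 3 :+ j) :+ (con 3 :+ j))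
        :* con 2) refl

lattice-min : ∀ m → 2 < m → ∀ v → v ≢ origin → 1 + m ^ 2 + m ^ 4 ≤ ‖ lattice (+ m) v ‖²
lattice-min (suc (suc (suc j))) (s≤s (s≤s (s≤s _))) v v≢0 = begin
  1 + m ^ 2 + m ^ 4                                       ≡⟨ weights-sum j ⟩
  diagWeightℕ j * 1 + pairWeightℕ m * 2
    ≤⟨ +-mono-≤ (*-monoʳ-≤ (diagWeightℕ j) (norm-positive v v≢0))
                (*-monoʳ-≤ (pairWeightℕ m) (pairSums-two v v≢0)) ⟩
  diagWeightℕ j * ‖ v ‖² + pairWeightℕ m * ‖ pairSums v ‖² ≡⟨ lattice-norm j v ⟨
  ‖ lattice (+ m) v ‖²                                    ∎
  where
  open ≤-Reasoning
  m = 3 + j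

cube : ∀ m → m ^ 3 ≡ m * m * m
cube = solve 1 (λ m → m :^ 3 := m :* m :* m) refl

far-apart : ∀ m → 2 < m → ∀ x y v → lift x ⊟ lift y ≡ lattice (+ m) v → v ≢ origin →
  1 + m ^ 2 + m ^ 4 ≤ distSq x y
far-apart m m>2 x y v difference v≢0 =
  subst (1 + m ^ 2 + m ^ 4 ≤_) (sym (trans (distSq-lift x y) (cong ‖_‖² difference)))
        (lattice-min m m>2 v v≢0)

distinct-points-far : ∀ m N → 2 < m → suc N ≡ m ^ 3 → ∀ {n n′} → n < N → n′ < N →
  pt N 1 m (m ^ 2) n ≢ pt N 1 m (m ^ 2) n′ →
  1 + m ^ 2 + m ^ 4 ≤ distSq (pt N 1 m (m ^ 2) n) (pt N 1 m (m ^ 2) n′)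
distinct-points-far m N m>2 N+1≡m³ {n} {n′} n<N n′<N x≢y =
  far-apart m m>2 (pt N 1 m (m ^ 2) n) (pt N 1 m (m ^ 2) n′) v difference
    (λ v≡0 → x≢y (cong (pt N 1 m (m ^ 2)) (same-index v≡0)))
  where
  description = points-differ-by-lattice m N (trans N+1≡m³ (cube m)) n<N n′<N
  v = proj₁ description
  difference = proj₁ (proj₂ description)
  same-index = proj₂ (proj₂ description)

square-below-N : ∀ k N → suc N ≡ (2 + k) ^ 3 → (2 + k) ^ 2 < N
square-below-N k N N+1≡m³ = ≤-pred (begin
  2 + m ^ 2                                        ≤⟨ m≤m+n _ _ ⟩
  2 + m ^ 2 + (k * k * k + 5 * k * k + 8 * k + 2)  ≡⟨ identity k ⟨
  m ^ 3                                            ≡⟨ N+1≡m³ ⟨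
  suc N                                            ∎)
  where
  open ≤-Reasoning
  m = 2 + k
  identity : ∀ k → (2 + k) ^ 3 ≡ 2 + (2 + k) ^ 2 + (k * k * k + 5 * k * k + 8 * k + 2)
  identity = solve 1 (λ k → (con 2 :+ k) :^ 3
    := con 2 :+ (con 2 :+ k) :^ 2 :+ (k :* k :* k :+ con 5 :* k :* k :+ con 8 :* k :+ con 2)) refl

m<N : ∀ k N → suc N ≡ (2 + k) ^ 3 → 2 + k < N
m<N k N N+1≡m³ = ≤-<-trans (m≤m*n (2 + k) ((2 + k) * 1)) (square-below-N k N N+1≡m³)

1<N : ∀ k N → suc N ≡ (2 + k) ^ 3 → 1 < N
1<N k N N+1≡m³ = ≤-<-trans (s≤s z≤n) (m<N k N N+1≡m³)

first-points : ∀ k N → suc N ≡ (2 + k) ^ 3 → let m = 2 + k in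
  pt N 1 m (m ^ 2) 0 ≡ (0 , 0 , 0) × pt N 1 m (m ^ 2) 1 ≡ (1 , m , m ^ 2)
first-points k N N+1≡m³ =
  cong₂ _,_ (mod-small 0 N 0<N) (cong₂ _,_ (mod-small 0 N 0<N) (mod-small 0 N 0<N)) ,
  cong₂ _,_ (mod-small 1 N (1<N k N N+1≡m³))
    (cong₂ _,_ (trans (cong (_mod N) (*-identityˡ m)) (mod-small m N (m<N k N N+1≡m³)))
               (trans (cong (_mod N) (*-identityˡ (m ^ 2)))
                      (mod-small (m ^ 2) N (square-below-N k N N+1≡m³))))
  where
  m = 2 + k
  0<N = <-trans (s≤s z≤n) (1<N k N N+1≡m³)

lambdaStar-cubic : ∀ m N → 2 < m → suc N ≡ m ^ 3 → IsLambdaStarSq N 1 m (m ^ 2) (1 + m ^ 2 + m ^ 4)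
lambdaStar-cubic m@(suc (suc k)) N m>2@(s≤s (s≤s (s≤s _))) N+1≡m³ =
  (pt N 1 m (m ^ 2) 0 , pt N 1 m (m ^ 2) 1 ,
   (0 , 0<N , refl) , (1 , 1<N k N N+1≡m³ , refl) , distinct , adjacent) ,
  λ { _ _ (n , n<N , refl) (n′ , n′<N , refl) → distinct-points-far m N m>2 N+1≡m³ n<N n′<N }
  where
  points = first-points k N N+1≡m³
  0<N = <-trans (s≤s z≤n) (1<N k N N+1≡m³)
  distinct : pt N 1 m (m ^ 2) 0 ≢ pt N 1 m (m ^ 2) 1
  distinct e = 0≢1+n (trans (sym (cong proj₁ (proj₁ points)))
                           (trans (cong proj₁ e) (cong proj₁ (proj₂ points))))
  adjacent : distSq (pt N 1 m (m ^ 2) 0) (pt N 1 m (m ^ 2) 1) ≡ 1 + m ^ 2 + m ^ 4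
  adjacent = trans (cong₂ distSq (proj₁ points) (proj₂ points))
                   (cong (λ x → 1 + m ^ 2 + x) (^-*-assoc m 2 2))

lambdaStar-unique : ∀ {N a b c d d′} →
  IsLambdaStarSq N a b c d → IsLambdaStarSq N a b c d′ → d ≡ d′
lambdaStar-unique ((x , y , x∈ , y∈ , x≢y , dxy≡d) , d-min) ((x′ , y′ , x′∈ , y′∈ , x′≢y′ , dx′y′≡d′) , d′-min) =
  ≤-antisym (subst (_ ≤_) dx′y′≡d′ (d-min x′ y′ x′∈ y′∈ x′≢y′))
            (subst (_ ≤_) dxy≡d (d′-min x y x∈ y∈ x≢y))

N⁴<s³ : ∀ m → .{{NonZero m}} → (m ^ 3 ∸ 1) ^ 4 < (1 + m ^ 2 + m ^ 4) ^ 3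
N⁴<s³ m = begin-strict
  (m ^ 3 ∸ 1) ^ 4    <⟨ ^-monoˡ-< 4 (subst (m ^ 3 ∸ 1 <_) (suc-pred (m ^ 3) {{m^n≢0 m 3}}) (n<1+n _)) ⟩
  (m ^ 3) ^ 4        ≡⟨ trans (^-*-assoc m 3 4) (sym (^-*-assoc m 4 3)) ⟩
  (m ^ 4) ^ 3        ≤⟨ ^-monoˡ-≤ 3 (m≤n+m (m ^ 4) (1 + m ^ 2)) ⟩
  (1 + m ^ 2 + m ^ 4) ^ 3 ∎
  where open ≤-Reasoning

s≤m³[m+1] : ∀ k → let m = 2 + k in 1 + m ^ 2 + m ^ 4 ≤ m ^ 3 * (m + 1)
s≤m³[m+1] k = subst (1 + (2 + k) ^ 2 + (2 + k) ^ 4 ≤_) (sym (identity k)) (m≤m+n _ _)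
  where
  identity : ∀ k → (2 + k) ^ 3 * (2 + k + 1)
                   ≡ (1 + (2 + k) ^ 2 + (2 + k) ^ 4) + (k * k * k + 5 * k * k + 8 * k + 3)
  identity = solve 1 (λ k → (con 2 :+ k) :^ 3 :* (con 2 :+ k :+ con 1)
    := (con 1 :+ (con 2 :+ k) :^ 2 :+ (con 2 :+ k) :^ 4)
       :+ (k :* k :* k :+ con 5 :* k :* k :+ con 8 :* k :+ con 3)) refl

m²[m-1]≤N : ∀ t → suc t ^ 2 * t ≤ suc t ^ 3 ∸ 1
m²[m-1]≤N t = subst (λ c → suc t ^ 2 * t ≤ c ∸ 1) (sym (identity t)) (m≤m+n _ _)
  where
  identity : ∀ t → suc t ^ 3 ≡ suc (suc t ^ 2 * t + (t * t + 2 * t))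
  identity = solve 1 (λ t → (con 1 :+ t) :^ 3
    := con 1 :+ ((con 1 :+ t) :^ 2 :* t :+ (t :* t :+ con 2 :* t))) refl

-- m(m + 1)³ = t⁴ + R(t) with t = m - 1, where R(t) ≤ 53t³ for t ≥ 1;
-- hence q·m(m + 1)³ < (q + 1)·t⁴ when 53q < t.
growth : ∀ q t → 53 * q < t → q * (suc t * (suc t + 1) ^ 3) < (q + 1) * t ^ 4
growth q t@(suc u) 53q<t = begin-strict
  q * (suc t * (suc t + 1) ^ 3) ≡⟨ cong (q *_) (expansion t) ⟩
  q * (t ^ 4 + R)               ≡⟨ *-distribˡ-+ q (t ^ 4) R ⟩
  q * t ^ 4 + q * R             ≤⟨ +-monoʳ-≤ (q * t ^ 4) (*-monoʳ-≤ q remainder) ⟩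
  q * t ^ 4 + q * (53 * t ^ 3)  ≡⟨ cong (λ x → q * t ^ 4 + x) (rearrange q (t ^ 3)) ⟩
  q * t ^ 4 + 53 * q * t ^ 3    <⟨ +-monoʳ-< (q * t ^ 4) (*-monoˡ-< (t ^ 3) 53q<t) ⟩
  q * t ^ 4 + t ^ 4             ≡⟨ distribute ⟨
  (q + 1) * t ^ 4                 ∎
  where
  open ≤-Reasoning
  R = 7 * t ^ 3 + 18 * t ^ 2 + 20 * t + 8
  expansion : ∀ t → suc t * (suc t + 1) ^ 3 ≡ t ^ 4 + (7 * t ^ 3 + 18 * t ^ 2 + 20 * t + 8)
  expansion = solve 1 (λ t → (con 1 :+ t) :* (con 1 :+ t :+ con 1) :^ 3
    := t :^ 4 :+ (con 7 :* t :^ 3 :+ con 18 :* t :^ 2 :+ con 20 :* t :+ con 8)) refl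
  remainder : R ≤ 53 * t ^ 3
  remainder = subst (R ≤_) (sym (cubic u)) (m≤m+n _ _)
    where
    cubic : ∀ u → 53 * suc u ^ 3 ≡ (7 * suc u ^ 3 + 18 * suc u ^ 2 + 20 * suc u + 8)
                                    + (46 * u ^ 3 + 120 * u ^ 2 + 82 * u)
    cubic = solve 1 (λ u → con 53 :* (con 1 :+ u) :^ 3
      := (con 7 :* (con 1 :+ u) :^ 3 :+ con 18 :* (con 1 :+ u) :^ 2 :+ con 20 :* (con 1 :+ u) :+ con 8)
         :+ (con 46 :* u :^ 3 :+ con 120 :* u :^ 2 :+ con 82 :* u)) refl
  rearrange : ∀ q x → q * (53 * x) ≡ 53 * q * x
  rearrange q x = trans (sym (*-assoc q 53 x)) (cong (_* x) (*-comm q 53))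
  distribute : (q + 1) * t ^ 4 ≡ q * t ^ 4 + t ^ 4
  distribute = trans (*-distribʳ-+ (t ^ 4) q 1) (cong (λ x → q * t ^ 4 + x) (*-identityˡ (t ^ 4)))

*-distrib-^ : ∀ n a b → (a * b) ^ n ≡ a ^ n * b ^ n
*-distrib-^ zero    a b = refl
*-distrib-^ (suc n) a b = trans (cong ((a * b) *_) (*-distrib-^ n a b)) (interchange a b (a ^ n) (b ^ n))
  where
  interchange : ∀ a b c d → a * b * (c * d) ≡ a * c * (b * d)
  interchange = solve-∀

-- q·s³ < (q + 1)·N⁴ once 53q < m - 1, from s ≤ m³(m + 1), N ≥ m²(m - 1) and growth.
s³-below-N⁴ : ∀ q t → 53 * q < t →
  q * (1 + suc t ^ 2 + suc t ^ 4) ^ 3 < (q + 1) * (suc t ^ 3 ∸ 1) ^ 4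
s³-below-N⁴ q t@(suc k) 53q<t = begin-strict
  q * (1 + m ^ 2 + m ^ 4) ^ 3       ≤⟨ *-monoʳ-≤ q (^-monoˡ-≤ 3 (s≤m³[m+1] k)) ⟩
  q * (m ^ 3 * (m + 1)) ^ 3         ≡⟨ cong (q *_) (*-distrib-^ 3 (m ^ 3) (m + 1)) ⟩
  q * ((m ^ 3) ^ 3 * (m + 1) ^ 3)   ≡⟨ cong (λ x → q * (x * (m + 1) ^ 3)) (^-*-assoc m 3 3) ⟩
  q * (m * m ^ 8 * (m + 1) ^ 3)     ≡⟨ regroup₁ q m (m ^ 8) ((m + 1) ^ 3) ⟩
  m ^ 8 * (q * (m * (m + 1) ^ 3))   <⟨ *-monoʳ-< (m ^ 8) {{m^n≢0 m 8}} (growth q t 53q<t) ⟩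
  m ^ 8 * ((q + 1) * t ^ 4)         ≡⟨ regroup₂ (m ^ 8) (q + 1) (t ^ 4) ⟩
  (q + 1) * (m ^ 8 * t ^ 4)         ≡⟨ cong (λ x → (q + 1) * (x * t ^ 4)) (^-*-assoc m 2 4) ⟨
  (q + 1) * ((m ^ 2) ^ 4 * t ^ 4)   ≡⟨ cong ((q + 1) *_) (*-distrib-^ 4 (m ^ 2) t) ⟨
  (q + 1) * (m ^ 2 * t) ^ 4         ≤⟨ *-monoʳ-≤ (q + 1) (^-monoˡ-≤ 4 (m²[m-1]≤N t)) ⟩
  (q + 1) * (m ^ 3 ∸ 1) ^ 4         ∎
  where
  open ≤-Reasoning
  m = suc t
  regroup₁ : ∀ q m a c → q * (m * a * c) ≡ a * (q * (m * c))
  regroup₁ = solve-∀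
  regroup₂ : ∀ a b c → a * (b * c) ≡ b * (a * c)
  regroup₂ = solve-∀

-- For 53q + 3 ≤ m:  ((q - p)/q)⁶·N⁴ < s³ < ((q + p)/q)⁶·N⁴, i.e. the ratio
-- s^{1/2}/N^{2/3} lies strictly between 1 - p/q and 1 + p/q.
ratio-bounds : ∀ p q → 0 < p → 0 < q → ∀ m → 53 * q + 3 ≤ m →
  ((q ∸ p) ^ 6 * (m ^ 3 ∸ 1) ^ 4 < (1 + m ^ 2 + m ^ 4) ^ 3 * q ^ 6)
  × ((1 + m ^ 2 + m ^ 4) ^ 3 * q ^ 6 < (q + p) ^ 6 * (m ^ 3 ∸ 1) ^ 4)
ratio-bounds p q@(suc _) 0<p _ m@(suc t) 53q+3≤m = lower , upper
  where
  open ≤-Reasoning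
  N = m ^ 3 ∸ 1
  s = 1 + m ^ 2 + m ^ 4
  53q<t : 53 * q < t
  53q<t = ≤-trans (n≤1+n _) (≤-pred (subst (_≤ m) (+-comm (53 * q) 3) 53q+3≤m))
  lower = begin-strict
    (q ∸ p) ^ 6 * N ^ 4  ≤⟨ *-monoˡ-≤ (N ^ 4) (^-monoˡ-≤ 6 (m∸n≤m q p)) ⟩
    q ^ 6 * N ^ 4        <⟨ *-monoʳ-< (q ^ 6) {{m^n≢0 q 6}} (N⁴<s³ m) ⟩
    q ^ 6 * s ^ 3        ≡⟨ *-comm (q ^ 6) (s ^ 3) ⟩
    s ^ 3 * q ^ 6        ∎
  q⁵[q+1]≤[q+p]⁶ : q ^ 5 * (q + 1) ≤ (q + p) ^ 6
  q⁵[q+1]≤[q+p]⁶ = ≤-trans (*-monoˡ-≤ (q + 1) (^-monoˡ-≤ 5 (m≤m+n q 1)))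
    (subst (_≤ (q + p) ^ 6) (*-comm (q + 1) ((q + 1) ^ 5)) (^-monoˡ-≤ 6 (+-monoʳ-≤ q 0<p)))
  upper = begin-strict
    s ^ 3 * q ^ 6               ≡⟨ regroup (s ^ 3) q (q ^ 5) ⟩
    q ^ 5 * (q * s ^ 3)         <⟨ *-monoʳ-< (q ^ 5) {{m^n≢0 q 5}} (s³-below-N⁴ q t 53q<t) ⟩
    q ^ 5 * ((q + 1) * N ^ 4)   ≡⟨ *-assoc (q ^ 5) (q + 1) (N ^ 4) ⟨
    q ^ 5 * (q + 1) * N ^ 4     ≤⟨ *-monoˡ-≤ (N ^ 4) q⁵[q+1]≤[q+p]⁶ ⟩
    (q + p) ^ 6 * N ^ 4         ∎
    where
    regroup : ∀ x q q⁵ → x * (q * q⁵) ≡ q⁵ * (q * x)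
    regroup = solve-∀

theorem2 :
    (∀ (m : ℕ) → 2 < m →
       IsLambdaStarSq (m ^ 3 ∸ 1) 1 m (m ^ 2) (1 + m ^ 2 + m ^ 4))
    × (∀ (p q : ℕ) → 0 < p → 0 < q →
         Σ ℕ λ M → ∀ (m : ℕ) → M ≤ m → 2 < m → ∀ (d : ℕ) →
           IsLambdaStarSq (m ^ 3 ∸ 1) 1 m (m ^ 2) d →
             ((q ∸ p) ^ 6 * (m ^ 3 ∸ 1) ^ 4 < d ^ 3 * q ^ 6)
             × (d ^ 3 * q ^ 6 < (q + p) ^ 6 * (m ^ 3 ∸ 1) ^ 4))
theorem2 = exact-value , asymptotics
  where
  exact-value : ∀ m → 2 < m → IsLambdaStarSq (m ^ 3 ∸ 1) 1 m (m ^ 2) (1 + m ^ 2 + m ^ 4)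
  exact-value m m>2@(s≤s _) =
    lambdaStar-cubic m (m ^ 3 ∸ 1) m>2 (suc-pred (m ^ 3) {{m^n≢0 m 3}})
  -- Any d with the λ*² property equals s, so ratio-bounds applies with M = 53q + 3.
  asymptotics : ∀ p q → 0 < p → 0 < q →
    Σ ℕ λ M → ∀ m → M ≤ m → 2 < m → ∀ d → IsLambdaStarSq (m ^ 3 ∸ 1) 1 m (m ^ 2) d →
      ((q ∸ p) ^ 6 * (m ^ 3 ∸ 1) ^ 4 < d ^ 3 * q ^ 6) × (d ^ 3 * q ^ 6 < (q + p) ^ 6 * (m ^ 3 ∸ 1) ^ 4)
  asymptotics p q 0<p 0<q = 53 * q + 3 , λ m M≤m m>2 d λ*²≡d →
    subst (λ d → ((q ∸ p) ^ 6 * (m ^ 3 ∸ 1) ^ 4 < d ^ 3 * q ^ 6)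
                 × (d ^ 3 * q ^ 6 < (q + p) ^ 6 * (m ^ 3 ∸ 1) ^ 4))
          (lambdaStar-unique (exact-value m m>2) λ*²≡d)
          (ratio-bounds p q 0<p 0<q m M≤m)
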